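{- Let $\mathcal{T}$ be a $2$-covered $3$-graph on $k\ge 7$ vertices. Suppose that $\tau(\mathcal{T}[S])\le 1$ for all sets $S\subset V(\mathcal{T})$ with $|S|=7$. Then $\mathcal{T}$ is a star.
   Context: A $3$-graph $\mathcal{T}$ is $2$-covered if every pair of distinct vertices of $\mathcal{T}$ is contained in some edge. $\mathcal{T}[S]$ is the subgraph induced on $S$ (edges of $\mathcal{T}$ contained in $S$). The transversal number $\tau(\mathcal{H})$ is the minimum size of a vertex set meeting every edge of $\mathcal{H}$ ($\tau=0$ if $\mathcal{H}$ has no edges). A $3$-graph is a star if all its edges contain a common fixed vertex. -}

module Defs where

open import Data.Nat using (ℕ; _≤_)
open import Data.Fin using (Fin)
open import Data.Fin.Subset using (Subset; _∈_; _⊆_; ∣_∣)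
open import Data.List using (List)
open import Data.List.Relation.Unary.All using (All)
open import Data.List.Relation.Unary.Any using (Any)
open import Data.Product using (Σ; ∃; _×_)
open import Relation.Binary.PropositionalEquality using (_≡_; _≢_)

record ThreeGraph (k : ℕ) : Set where
  field
    edges   : List (Subset k)
    uniform : All (λ e → ∣ e ∣ ≡ 3) edges
open ThreeGraph public

_∈E_ : {k : ℕ} → Subset k → List (Subset k) → Set
e ∈E es = Any (e ≡_) es

TwoCovered : {k : ℕ} → ThreeGraph k → Set
TwoCovered {k} T =
  (x y : Fin k) → x ≢ y →
  ∃ λ e → e ∈E edges T × x ∈ e × y ∈ e

InducedEdge : {k : ℕ} → ThreeGraph k → Subset k → Subset k → Set
InducedEdge T S e = e ∈E edges T × e ⊆ S

IsTransversalInduced : {k : ℕ} → ThreeGraph k → Subset k → Subset k → Set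
IsTransversalInduced {k} T S X =
  (e : Subset k) → InducedEdge T S e → ∃ λ v → v ∈ X × v ∈ e

TauInducedAtMost : {k : ℕ} → ThreeGraph k → Subset k → ℕ → Set
TauInducedAtMost {k} T S n =
  ∃ λ (X : Subset k) → ∣ X ∣ ≤ n × IsTransversalInduced T S X

IsStar : {k : ℕ} → ThreeGraph k → Set
IsStar {k} T = ∃ λ (v : Fin k) → (e : Subset k) → e ∈E edges T → v ∈ e

module Submission where

-- Extending any vertex set U with |U| ≤ 7 to a 7-set
-- shows τ(T[U]) ≤ 1, so all edges of T contained in U meet one common
-- vertex.  Since edges have 3 vertices, inclusion–exclusion bounds the
-- span of small edge families: two edges span ≤ 6 vertices, so any two
-- edges intersect; then three edges span ≤ 7 vertices, so any three edges
-- share a vertex.  Now fix an edge e = {a, b, c} (one exists because T is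
-- 2-covered).  If none of a, b, c lies in every edge, choose edges
-- fa ∌ a, fb ∌ b, fc ∌ c.  By three-wise intersection, fa ∩ fb ∩ e = {c},
-- fa ∩ fc ∩ e = {b}, fb ∩ fc ∩ e = {a}; hence e, fa, fb, fc span at most
-- 3 + 1 + 1 + 1 = 6 vertices and so share a vertex, which must lie in e,
-- a contradiction.  So some vertex of e lies in every edge: T is a star.

open import Defs
open import Data.Nat using (ℕ; zero; suc; _+_; _∸_; _≤_; z≤n; s≤s; _≤?_)
open import Data.Nat.Properties
  using (≤-trans; ≤-reflexive; ≤-antisym; ≰⇒>; n≤1+n; +-suc; +-monoʳ-≤; +-mono-≤; m+n≤o⇒m≤o∸n; module ≤-Reasoning)
open import Data.Fin using (Fin; zero; suc; _≟_)
open import Data.Fin.Properties using (suc-injective)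
open import Data.Fin.Subset using (Subset; inside; outside; _∈_; _∉_; _⊆_; _∪_; _∩_; ⋃; ⁅_⁆; ∣_∣)
open import Data.Fin.Subset.Properties
  using (_∈?_; p⊆q⇒∣p∣≤∣q∣; ∣⁅x⁆∣≡1; x∈⁅y⁆⇒x≡y; x∈p⇒∣p-x∣<∣p∣; x∈p∧x≢y⇒x∈p-y;
         x∈p∩q⁺; p⊆p∪q; q⊆p∪q; ∪-identityʳ; out⊆; in⊆in)
open import Data.Vec using ([]; _∷_)
open import Data.Vec.Base using (here; there)
open import Data.List using (List; []; _∷_; length; map)
open import Data.List.Properties using (length-map)
open import Data.List.Membership.Propositional using (find) renaming (_∈_ to _∈ₗ_)
open import Data.List.Membership.Propositional.Properties using (∈-map⁺)
open import Data.List.Relation.Unary.All as All using (All; []; _∷_; all?)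
import Data.List.Relation.Unary.All.Properties as All
import Data.List.Relation.Unary.Any as Any
open import Data.List.Relation.Unary.AllPairs using ([]; _∷_)
open import Data.List.Relation.Unary.Unique.Propositional using (Unique)
import Data.List.Relation.Unary.Unique.Propositional.Properties as Unique
open import Data.Product using (∃; _×_; _,_; proj₁; proj₂)
open import Data.Sum using (_⊎_; inj₁; inj₂)
open import Data.Empty using (⊥; ⊥-elim)
open import Function using (_∘_; id; case_of_)
open import Relation.Nullary using (yes; no)
open import Relation.Binary.PropositionalEquality using (_≡_; _≢_; refl; sym; trans; cong; subst; module ≡-Reasoning)

card-∪-∩ : ∀ {n} (p q : Subset n) → ∣ p ∪ q ∣ + ∣ p ∩ q ∣ ≡ ∣ p ∣ + ∣ q ∣
card-∪-∩ [] [] = refl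
card-∪-∩ (inside ∷ p) (inside ∷ q) = begin
  suc (∣ p ∪ q ∣ + suc ∣ p ∩ q ∣)    ≡⟨ cong suc (+-suc ∣ p ∪ q ∣ ∣ p ∩ q ∣) ⟩
  suc (suc (∣ p ∪ q ∣ + ∣ p ∩ q ∣))  ≡⟨ cong (2 +_) (card-∪-∩ p q) ⟩
  suc (suc (∣ p ∣ + ∣ q ∣))          ≡⟨ cong suc (sym (+-suc ∣ p ∣ ∣ q ∣)) ⟩
  suc (∣ p ∣ + suc ∣ q ∣)            ∎
  where open ≡-Reasoning
card-∪-∩ (inside ∷ p) (outside ∷ q) = cong suc (card-∪-∩ p q)
card-∪-∩ (outside ∷ p) (inside ∷ q) =
  trans (cong suc (card-∪-∩ p q)) (sym (+-suc ∣ p ∣ ∣ q ∣))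
card-∪-∩ (outside ∷ p) (outside ∷ q) = card-∪-∩ p q

∣p∪q∣≤ : ∀ {n} (p q : Subset n) {a b t : ℕ} →
  ∣ p ∣ ≤ a → ∣ q ∣ ≤ b → t ≤ ∣ p ∩ q ∣ → ∣ p ∪ q ∣ ≤ a + b ∸ t
∣p∪q∣≤ p q {a} {b} {t} p≤a q≤b t≤p∩q = m+n≤o⇒m≤o∸n ∣ p ∪ q ∣ (begin
  ∣ p ∪ q ∣ + t            ≤⟨ +-monoʳ-≤ ∣ p ∪ q ∣ t≤p∩q ⟩
  ∣ p ∪ q ∣ + ∣ p ∩ q ∣    ≡⟨ card-∪-∩ p q ⟩
  ∣ p ∣ + ∣ q ∣            ≤⟨ +-mono-≤ p≤a q≤b ⟩
  a + b                    ∎)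
  where open ≤-Reasoning

∈⇒1≤∣p∣ : ∀ {n} {x : Fin n} {p : Subset n} → x ∈ p → 1 ≤ ∣ p ∣
∈⇒1≤∣p∣ {x = x} {p} x∈p = subst (_≤ ∣ p ∣) (∣⁅x⁆∣≡1 x) (p⊆q⇒∣p∣≤∣q∣ ⁅x⁆⊆p)
  where
  ⁅x⁆⊆p : ⁅ x ⁆ ⊆ p
  ⁅x⁆⊆p y∈⁅x⁆ = subst (_∈ p) (sym (x∈⁅y⁆⇒x≡y x y∈⁅x⁆)) x∈p

∈∈⇒2≤∣p∣ : ∀ {n} {x y : Fin n} {p : Subset n} → x ∈ p → y ∈ p → x ≢ y → 2 ≤ ∣ p ∣
∈∈⇒2≤∣p∣ x∈p y∈p x≢y =
  ≤-trans (s≤s (∈⇒1≤∣p∣ (x∈p∧x≢y⇒x∈p-y y∈p (x≢y ∘ sym)))) (x∈p⇒∣p-x∣<∣p∣ x∈p)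

∣p∣≤1⇒unique : ∀ {n} {x y : Fin n} {p : Subset n} → ∣ p ∣ ≤ 1 → x ∈ p → y ∈ p → x ≡ y
∣p∣≤1⇒unique {x = x} {y} ∣p∣≤1 x∈p y∈p with x ≟ y
... | yes x≡y = x≡y
... | no x≢y with ≤-trans (∈∈⇒2≤∣p∣ x∈p y∈p x≢y) ∣p∣≤1
...   | s≤s ()

extend : ∀ {n} (U : Subset n) (m : ℕ) → ∣ U ∣ ≤ m → m ≤ n → ∃ λ S → U ⊆ S × ∣ S ∣ ≡ m
extend [] zero _ _ = [] , id , refl
extend (inside ∷ U) (suc m) (s≤s U≤m) (s≤s m≤n) =
  let S , U⊆S , ∣S∣≡m = extend U m U≤m m≤n in inside ∷ S , in⊆in U⊆S , cong suc ∣S∣≡m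
extend (outside ∷ U) zero U≤0 _ =
  let S , U⊆S , ∣S∣≡0 = extend U zero U≤0 z≤n in outside ∷ S , out⊆ U⊆S , ∣S∣≡0
extend {suc n} (outside ∷ U) (suc m) U≤1+m (s≤s m≤n) with ∣ U ∣ ≤? m
... | yes U≤m = let S , U⊆S , ∣S∣≡m = extend U m U≤m m≤n in inside ∷ S , out⊆ U⊆S , cong suc ∣S∣≡m
... | no  U≰m = outside ∷ U , id , ≤-antisym U≤1+m (≰⇒> U≰m)

record Enumeration {n} (p : Subset n) : Set where
  field
    elements : List (Fin n)
    distinct : Unique elements
    size     : length elements ≡ ∣ p ∣
    sound    : All (_∈ p) elements
    complete : ∀ {x} → x ∈ p → x ∈ₗ elements

shift : ∀ {n} {p : Subset n} → Enumeration p → Enumeration (outside ∷ p)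
shift E = record
  { elements = map suc elements
  ; distinct = Unique.map⁺ suc-injective distinct
  ; size     = trans (length-map suc elements) size
  ; sound    = All.map⁺ (All.map there sound)
  ; complete = λ { (there x∈p) → ∈-map⁺ suc (complete x∈p) } }
  where open Enumeration E

add-zero : ∀ {n} {p : Subset n} → Enumeration (outside ∷ p) → Enumeration (inside ∷ p)
add-zero E = record
  { elements = zero ∷ elements
  ; distinct = All.map (λ { (there _) () }) sound ∷ distinct
  ; size     = cong suc size
  ; sound    = here ∷ All.map (out⊆ id) sound
  ; complete = λ { here → Any.here refl ; (there x∈p) → Any.there (complete (there x∈p)) } }
  where open Enumeration E

enumerate : ∀ {n} (p : Subset n) → Enumeration p
enumerate [] = record { elements = [] ; distinct = [] ; size = refl ; sound = [] ; complete = λ () }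
enumerate (inside ∷ p)  = add-zero (shift (enumerate p))
enumerate (outside ∷ p) = shift (enumerate p)

record Triple {n} (e : Subset n) : Set where
  field
    a b c       : Fin n
    a≢b         : a ≢ b
    a≢c         : a ≢ c
    b≢c         : b ≢ c
    a∈e         : a ∈ e
    b∈e         : b ∈ e
    c∈e         : c ∈ e
    only-abc    : ∀ {x} → x ∈ e → x ≡ a ⊎ x ≡ b ⊎ x ≡ c

  by-cases : ∀ {x} {R : Set} (P : Fin n → Set) → x ∈ e → P x →
             (P a → R) → (P b → R) → (P c → R) → R
  by-cases P x∈e px ka kb kc with only-abc x∈e
  ... | inj₁ refl        = ka px
  ... | inj₂ (inj₁ refl) = kb px
  ... | inj₂ (inj₂ refl) = kc px

triple : ∀ {n} (e : Subset n) → ∣ e ∣ ≡ 3 → Triple e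
triple e ∣e∣≡3 = from-list elements distinct (trans size ∣e∣≡3) sound complete
  where
  open Enumeration (enumerate e)
  from-list : ∀ xs → Unique xs → length xs ≡ 3 → All (_∈ e) xs →
              (∀ {x} → x ∈ e → x ∈ₗ xs) → Triple e
  from-list (a ∷ b ∷ c ∷ []) ((a≢b ∷ a≢c ∷ []) ∷ (b≢c ∷ []) ∷ [] ∷ []) refl
            (a∈e ∷ b∈e ∷ c∈e ∷ []) complete = record
    { a = a ; b = b ; c = c ; a≢b = a≢b ; a≢c = a≢c ; b≢c = b≢c
    ; a∈e = a∈e ; b∈e = b∈e ; c∈e = c∈e ; only-abc = one-of ∘ complete }
    where
    one-of : ∀ {x} → x ∈ₗ (a ∷ b ∷ c ∷ []) → x ≡ a ⊎ x ≡ b ⊎ x ≡ c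
    one-of (Any.here x≡a)                       = inj₁ x≡a
    one-of (Any.there (Any.here x≡b))           = inj₂ (inj₁ x≡b)
    one-of (Any.there (Any.there (Any.here x≡c))) = inj₂ (inj₂ x≡c)

⊆-⋃ : ∀ {n} (fs : List (Subset n)) → All (_⊆ ⋃ fs) fs
⊆-⋃ [] = []
⊆-⋃ (f ∷ fs) = p⊆p∪q (⋃ fs) ∷ All.map (λ g⊆⋃fs {x} x∈g → q⊆p∪q f (⋃ fs) (g⊆⋃fs x∈g)) (⊆-⋃ fs)

module SmallTransversals {k : ℕ} (7≤k : 7 ≤ k) (T : ThreeGraph k)
  (τ≤1 : (S : Subset k) → ∣ S ∣ ≡ 7 → TauInducedAtMost T S 1) where

  Center : Fin k → Set
  Center v = (e : Subset k) → e ∈E edges T → v ∈ e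

  edge-size : ∀ {e} → e ∈E edges T → ∣ e ∣ ≡ 3
  edge-size = All.lookup (uniform T)

  edge≤3 : ∀ {e} → e ∈E edges T → ∣ e ∣ ≤ 3
  edge≤3 = ≤-reflexive ∘ edge-size

  ∣⋃[e]∣≤3 : ∀ {e} → e ∈E edges T → ∣ ⋃ (e ∷ []) ∣ ≤ 3
  ∣⋃[e]∣≤3 {e} e∈T = ≤-reflexive (trans (cong ∣_∣ (∪-identityʳ e)) (edge-size e∈T))

  -- τ(T[U]) ≤ 1 also for the smaller sets |U| ≤ 7, by extending U to a 7-set.
  τ≤1-small : (U : Subset k) → ∣ U ∣ ≤ 7 → TauInducedAtMost T U 1
  τ≤1-small U ∣U∣≤7 =
    let S , U⊆S , ∣S∣≡7 = extend U 7 ∣U∣≤7 7≤k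
        X , ∣X∣≤1 , meets = τ≤1 S ∣S∣≡7
    in X , ∣X∣≤1 , λ e (e∈T , e⊆U) → meets e (e∈T , U⊆S ∘ e⊆U)

  common-vertex : ∀ f fs → All (_∈E edges T) (f ∷ fs) → ∣ ⋃ (f ∷ fs) ∣ ≤ 7 →
                  ∃ λ v → All (v ∈_) (f ∷ fs)
  common-vertex f fs are-edges small = through-single-vertex (τ≤1-small (⋃ (f ∷ fs)) small)
    where
    -- Each edge of the family meets X, and |X| ≤ 1 forces the same vertex.
    through-single-vertex : TauInducedAtMost T (⋃ (f ∷ fs)) 1 → ∃ λ v → All (v ∈_) (f ∷ fs)
    through-single-vertex (X , ∣X∣≤1 , meets) =
      let v , v∈X , _ = hit (Any.here refl)
      in v , All.tabulate λ g∈fs → let w , w∈X , w∈g = hit g∈fs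
                                   in subst (_∈ _) (∣p∣≤1⇒unique ∣X∣≤1 w∈X v∈X) w∈g
      where
      hit : ∀ {g} → g ∈ₗ (f ∷ fs) → ∃ λ w → w ∈ X × w ∈ g
      hit g∈fs = meets _ (All.lookup are-edges g∈fs , All.lookup (⊆-⋃ (f ∷ fs)) g∈fs)

  -- Any two edges intersect (together they span ≤ 6 vertices).
  intersecting : ∀ {e f} → e ∈E edges T → f ∈E edges T → ∃ λ v → v ∈ e × v ∈ f
  intersecting {e} {f} e∈T f∈T =
    case common-vertex e (f ∷ []) (e∈T ∷ f∈T ∷ []) (≤-trans span≤6 (n≤1+n 6)) of
      λ { (v , v∈e ∷ v∈f ∷ []) → v , v∈e , v∈f }
    where
    span≤6 : ∣ ⋃ (e ∷ f ∷ []) ∣ ≤ 6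
    span≤6 = ∣p∪q∣≤ e (⋃ (f ∷ [])) (edge≤3 e∈T) (∣⋃[e]∣≤3 f∈T) z≤n

  -- Three edges, consecutive ones meeting, span at most 3 + 2 + 2 = 7 vertices.
  span-of-chain : ∀ {e f g v w} → e ∈E edges T → f ∈E edges T → g ∈E edges T →
                  v ∈ e → v ∈ f → w ∈ f → w ∈ g → ∣ ⋃ (e ∷ f ∷ g ∷ []) ∣ ≤ 7
  span-of-chain {e} {f} {g} e∈T f∈T g∈T v∈e v∈f w∈f w∈g =
    ∣p∪q∣≤ e (⋃ (f ∷ g ∷ [])) (edge≤3 e∈T) f∪g≤5 (∈⇒1≤∣p∣ (x∈p∩q⁺ (v∈e , p⊆p∪q _ v∈f)))
    where
    f∪g≤5 : ∣ ⋃ (f ∷ g ∷ []) ∣ ≤ 5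
    f∪g≤5 = ∣p∪q∣≤ f (⋃ (g ∷ [])) (edge≤3 f∈T) (∣⋃[e]∣≤3 g∈T) (∈⇒1≤∣p∣ (x∈p∩q⁺ (w∈f , p⊆p∪q _ w∈g)))

  -- Any three edges share a vertex, since any two edges intersect.
  three-wise : ∀ {e f g} → e ∈E edges T → f ∈E edges T → g ∈E edges T →
               ∃ λ v → v ∈ e × v ∈ f × v ∈ g
  three-wise {e} {f} {g} e∈T f∈T g∈T =
    let v , v∈e , v∈f = intersecting e∈T f∈T
        w , w∈f , w∈g = intersecting f∈T g∈T
    in case common-vertex e (f ∷ g ∷ []) (e∈T ∷ f∈T ∷ g∈T ∷ [])
              (span-of-chain e∈T f∈T g∈T v∈e v∈f w∈f w∈g) of
         λ { (u , u∈e ∷ u∈f ∷ u∈g ∷ []) → u , u∈e , u∈f , u∈g }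

  center-or-avoided : (v : Fin k) → Center v ⊎ ∃ λ f → f ∈E edges T × v ∉ f
  center-or-avoided v with all? (v ∈?_) (edges T)
  ... | yes v∈all = inj₁ λ _ → All.lookup v∈all
  ... | no  v∉all = inj₂ (find (All.¬All⇒Any¬ (v ∈?_) (edges T) v∉all))

  module ThroughEdge {e : Subset k} (e∈T : e ∈E edges T) (t : Triple e) where
    open Triple t

    -- Two edges avoiding two of a, b, c both contain the third one,
    -- since they meet e in a common vertex.
    c-shared : ∀ {fa fb} → fa ∈E edges T → a ∉ fa → fb ∈E edges T → b ∉ fb → c ∈ fa × c ∈ fb
    c-shared {fa} {fb} fa∈T a∉fa fb∈T b∉fb = let w , w∈e , w∈fa , w∈fb = three-wise e∈T fa∈T fb∈T in
      by-cases (λ x → x ∈ fa × x ∈ fb) w∈e (w∈fa , w∈fb)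
        (⊥-elim ∘ a∉fa ∘ proj₁) (⊥-elim ∘ b∉fb ∘ proj₂) id

    b-shared : ∀ {fa fc} → fa ∈E edges T → a ∉ fa → fc ∈E edges T → c ∉ fc → b ∈ fa × b ∈ fc
    b-shared {fa} {fc} fa∈T a∉fa fc∈T c∉fc = let w , w∈e , w∈fa , w∈fc = three-wise e∈T fa∈T fc∈T in
      by-cases (λ x → x ∈ fa × x ∈ fc) w∈e (w∈fa , w∈fc)
        (⊥-elim ∘ a∉fa ∘ proj₁) id (⊥-elim ∘ c∉fc ∘ proj₂)

    a-shared : ∀ {fb fc} → fb ∈E edges T → b ∉ fb → fc ∈E edges T → c ∉ fc → a ∈ fb × a ∈ fc
    a-shared {fb} {fc} fb∈T b∉fb fc∈T c∉fc = let w , w∈e , w∈fb , w∈fc = three-wise e∈T fb∈T fc∈T in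
      by-cases (λ x → x ∈ fb × x ∈ fc) w∈e (w∈fb , w∈fc)
        id (⊥-elim ∘ b∉fb ∘ proj₁) (⊥-elim ∘ c∉fc ∘ proj₂)

    -- If fa ⊇ {b, c}, fb ⊇ {a, c} and fc ⊇ {a, b}, then e, fa, fb, fc span
    -- at most 6 vertices: each new edge shares two vertices of e with the
    -- union so far, giving 3 + 1 + 1 + 1.
    span-of-avoiders : ∀ {fa fb fc} → fa ∈E edges T → fb ∈E edges T → fc ∈E edges T →
      b ∈ fa → c ∈ fa → a ∈ fb → c ∈ fb → a ∈ fc → b ∈ fc →
      ∣ ⋃ (fc ∷ fb ∷ fa ∷ e ∷ []) ∣ ≤ 6
    span-of-avoiders {fa} {fb} {fc} fa∈T fb∈T fc∈T b∈fa c∈fa a∈fb c∈fb a∈fc b∈fc =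
      ∣p∪q∣≤ fc U₃ (edge≤3 fc∈T) U₃≤5 (two-shared a∈fc b∈fc (in-U₃ a∈e) (in-U₃ b∈e) a≢b)
      where
      U₁ U₂ U₃ : Subset k
      U₁ = ⋃ (e ∷ [])
      U₂ = fa ∪ U₁
      U₃ = fb ∪ U₂
      in-U₂ : ∀ {x} → x ∈ e → x ∈ U₂
      in-U₂ x∈e = q⊆p∪q fa U₁ (p⊆p∪q _ x∈e)
      in-U₃ : ∀ {x} → x ∈ e → x ∈ U₃
      in-U₃ x∈e = q⊆p∪q fb U₂ (in-U₂ x∈e)
      two-shared : ∀ {x y f U} → x ∈ f → y ∈ f → x ∈ U → y ∈ U → x ≢ y → 2 ≤ ∣ f ∩ U ∣
      two-shared x∈f y∈f x∈U y∈U = ∈∈⇒2≤∣p∣ (x∈p∩q⁺ (x∈f , x∈U)) (x∈p∩q⁺ (y∈f , y∈U))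
      U₂≤4 : ∣ U₂ ∣ ≤ 4
      U₂≤4 = ∣p∪q∣≤ fa U₁ (edge≤3 fa∈T) (∣⋃[e]∣≤3 e∈T)
        (two-shared b∈fa c∈fa (p⊆p∪q _ b∈e) (p⊆p∪q _ c∈e) b≢c)
      U₃≤5 : ∣ U₃ ∣ ≤ 5
      U₃≤5 = ∣p∪q∣≤ fb U₂ (edge≤3 fb∈T) U₂≤4 (two-shared a∈fb c∈fb (in-U₂ a∈e) (in-U₂ c∈e) a≢c)

    -- No three edges fa, fb, fc avoid a, b, c respectively: they would
    -- share a vertex with e, which would have to be a, b or c.
    no-avoiders : ∀ {fa fb fc} → fa ∈E edges T → a ∉ fa → fb ∈E edges T → b ∉ fb →
                  fc ∈E edges T → c ∉ fc → ⊥
    no-avoiders {fa} {fb} {fc} fa∈T a∉fa fb∈T b∉fb fc∈T c∉fc = not-in-e common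
      where
      c∈fa∩fb : c ∈ fa × c ∈ fb
      c∈fa∩fb = c-shared fa∈T a∉fa fb∈T b∉fb
      b∈fa∩fc : b ∈ fa × b ∈ fc
      b∈fa∩fc = b-shared fa∈T a∉fa fc∈T c∉fc
      a∈fb∩fc : a ∈ fb × a ∈ fc
      a∈fb∩fc = a-shared fb∈T b∉fb fc∈T c∉fc
      span≤6 : ∣ ⋃ (fc ∷ fb ∷ fa ∷ e ∷ []) ∣ ≤ 6
      span≤6 = span-of-avoiders fa∈T fb∈T fc∈T (proj₁ b∈fa∩fc) (proj₁ c∈fa∩fb)
                 (proj₁ a∈fb∩fc) (proj₂ c∈fa∩fb) (proj₂ a∈fb∩fc) (proj₂ b∈fa∩fc)
      common : ∃ λ w → All (w ∈_) (fc ∷ fb ∷ fa ∷ e ∷ [])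
      common = common-vertex fc (fb ∷ fa ∷ e ∷ []) (fc∈T ∷ fb∈T ∷ fa∈T ∷ e∈T ∷ [])
                 (≤-trans span≤6 (n≤1+n 6))
      not-in-e : (∃ λ w → All (w ∈_) (fc ∷ fb ∷ fa ∷ e ∷ [])) → ⊥
      not-in-e (w , w∈fc ∷ w∈fb ∷ w∈fa ∷ w∈e ∷ []) =
        by-cases (λ x → x ∈ fa × x ∈ fb × x ∈ fc) w∈e (w∈fa , w∈fb , w∈fc)
          (a∉fa ∘ proj₁) (b∉fb ∘ proj₁ ∘ proj₂) (c∉fc ∘ proj₂ ∘ proj₂)

    star : IsStar T
    star with center-or-avoided a | center-or-avoided b | center-or-avoided c
    ... | inj₁ a-center | _ | _ = a , a-center
    ... | inj₂ _ | inj₁ b-center | _ = b , b-center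
    ... | inj₂ _ | inj₂ _ | inj₁ c-center = c , c-center
    ... | inj₂ (fa , fa∈T , a∉fa) | inj₂ (fb , fb∈T , b∉fb) | inj₂ (fc , fc∈T , c∉fc) =
      ⊥-elim (no-avoiders fa∈T a∉fa fb∈T b∉fb fc∈T c∉fc)

lemma4p4 : (k : ℕ) → 7 ≤ k → (T : ThreeGraph k) → TwoCovered T →
    ((S : Subset k) → ∣ S ∣ ≡ 7 → TauInducedAtMost T S 1) →
    IsStar T
lemma4p4 zero () T two-covered τ≤1
lemma4p4 (suc zero) (s≤s ()) T two-covered τ≤1
lemma4p4 (suc (suc k)) 7≤k T two-covered τ≤1 = ThroughEdge.star e∈T (triple e (edge-size e∈T))
  where
  open SmallTransversals 7≤k T τ≤1
  -- T has an edge, since the pair {0, 1} is covered.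
  edge01 : ∃ λ e → e ∈E edges T × zero ∈ e × suc zero ∈ e
  edge01 = two-covered zero (suc zero) (λ ())
  e : Subset (suc (suc k))
  e = proj₁ edge01
  e∈T : e ∈E edges T
  e∈T = proj₁ (proj₂ edge01)
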